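{- Let $\mathcal C=(\Lambda,R)$ be a uniformly reactive chemical reaction network with $R\neq\emptyset$, let $o=\operatorname{ord}(\mathcal C)$, let $v\in\mathbb R_{>0}$, and let $\vec c\in\mathbb N^\Lambda$ be a configuration with $\|\vec c\|\ge o$. Let $\mathbf X$ be the random reactant vector $\vec r\in\mathbb N^\Lambda_{o}$ of the next reaction chosen by the Gillespie algorithm on $\vec c$ in volume $v$ (i.e. reaction $\alpha$ is chosen with probability $p_{\vec c,v}(\alpha)/\sum_{\beta\in R}p_{\vec c,v}(\beta)$, and $\mathbf X$ is its reactant vector). Let $\mathbf Y$ be the multiset (element of $\mathbb N^\Lambda_o$) of species of $o$ molecules drawn from the $\|\vec c\|$ molecules of $\vec c$, picking individual molecules uniformly at random without replacement. Then $\mathbf X$ and $\mathbf Y$ have the same distribution.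
   Context: A chemical reaction network (CRN) is a pair $\mathcal C=(\Lambda,R)$ with $\Lambda$ a finite set of species and $R$ a finite set of reactions $\alpha=(\vec r,\vec p,k)\in\mathbb N^\Lambda\times\mathbb N^\Lambda\times\mathbb R_{>0}$ (reactants, products, rate constant). A configuration is $\vec c\in\mathbb N^\Lambda$, with $\|\vec c\|=\sum_{A}\vec c(A)$ its number of molecules; $\mathbb N^\Lambda_i=\{\vec r:\|\vec r\|=i\}$. The order of $\alpha$ is $\|\vec r\|$, and $\operatorname{ord}(\mathcal C)$ is the maximum order of its reactions; the generativity of $\alpha$ is $\|\vec p\|-\|\vec r\|$. $\mathcal C$ is uniform if all reactions have the same order and the same generativity. The total rate constant of $\vec r$ is $K_{\mathcal C}(\vec r)=\sum_{(\vec r,\vec p,k)\in R}k$ (sum over reactions with reactant vector exactly $\vec r$). A uniform CRN is uniformly reactive if $K_{\mathcal C}(\vec r)=K_{\mathcal C}(\vec r')$ for all $\vec r,\vec r'\in\mathbb N^\Lambda_{\operatorname{ord}(\mathcal C)}$. The propensity of $\alpha=(\vec r,\vec p,k)$ in configuration $\vec c$ and volume $v$ is $p_{\vec c,v}(\alpha)=\frac{k}{v^{\|\vec r\|-1}}\prod_{A\in\Lambda}\frac{\vec c(A)^{\underline{\vec r(A)}}}{\vec r(A)!}$, where $a^{\underline b}=a(a-1)\cdots(a-b+1)$ is the falling power. -}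

module Defs where

open import Level using (Level; _⊔_) renaming (suc to lsuc)
open import Algebra.Core using (Op₁; Op₂)
open import Algebra.Structures using (IsCommutativeRing)
open import Relation.Binary.Core using (Rel)
open import Relation.Binary.Structures using (IsStrictTotalOrder)
open import Relation.Binary.PropositionalEquality using (_≡_)
open import Relation.Nullary using (¬_; Dec)
open import Data.Nat as ℕ using (ℕ; zero; suc; _≤_)
open import Data.Nat.Properties using () renaming (_≟_ to _≟ℕ_)
open import Data.Integer as ℤ using (ℤ; +_)
open import Data.Fin using (Fin)
import Data.Fin
open import Data.Product using (_×_; _,_)
open import Data.List as List using (List; []; _∷_; length; filter; map; concatMap; replicate; concat)
open import Data.List.Membership.Propositional using (_∈_)
open import Data.List.Relation.Unary.All using (All)
open import Data.Vec as Vec using (Vec)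
open import Data.Vec.Properties using (≡-dec)

-- An ordered field (ℝ is an instance).  Inverse is total; only its
-- value on nonzero elements is constrained.

record OrderedField c ℓ₁ ℓ₂ : Set (lsuc (c ⊔ ℓ₁ ⊔ ℓ₂)) where
  infixl 7 _*_
  infixl 6 _+_
  infix  4 _≈_ _<_
  field
    Carrier : Set c
    _≈_     : Rel Carrier ℓ₁
    _<_     : Rel Carrier ℓ₂
    _+_ _*_ : Op₂ Carrier
    -_      : Op₁ Carrier
    0# 1#   : Carrier
    _⁻¹     : Op₁ Carrier
    isCommutativeRing : IsCommutativeRing _≈_ _+_ _*_ -_ 0# 1#
    isStrictTotalOrder : IsStrictTotalOrder _≈_ _<_
    +-monoˡ-< : ∀ {x y} z → x < y → x + z < y + z
    *-pos : ∀ {x y} → 0# < x → 0# < y → 0# < x * y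
    0<1 : 0# < 1#
    *-inverse : ∀ x → ¬ (x ≈ 0#) → x * (x ⁻¹) ≈ 1#

_^fall_ : ℕ → ℕ → ℕ
a ^fall zero = 1
a ^fall suc b = a ℕ.* (ℕ.pred a ^fall b)

‖_‖ : ∀ {m} → Vec ℕ m → ℕ
‖ c ‖ = Vec.sum c

_≟v_ : ∀ {m} (x y : Vec ℕ m) → Dec (x ≡ y)
_≟v_ = ≡-dec _≟ℕ_

-- Chemical reaction networks over species Λ = Fin m, with rate
-- constants in an ordered field F (the paper: F = ℝ).

module CRN {c ℓ₁ ℓ₂} (F : OrderedField c ℓ₁ ℓ₂) where
  open OrderedField F

  record Reaction (m : ℕ) : Set c where
    constructor mkReaction
    field
      reactants : Vec ℕ m
      products  : Vec ℕ m
      rate      : Carrier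
  open Reaction public

  CRNet : ℕ → Set c
  CRNet m = List (Reaction m)

  ValidRates : ∀ {m} → CRNet m → Set (c ⊔ ℓ₂)
  ValidRates R = All (λ α → 0# < rate α) R

  order : ∀ {m} → Reaction m → ℕ
  order α = ‖ reactants α ‖

  ord : ∀ {m} → CRNet m → ℕ
  ord R = List.foldr ℕ._⊔_ 0 (map order R)

  generativity : ∀ {m} → Reaction m → ℤ
  generativity α = (+ ‖ products α ‖) ℤ.- (+ ‖ reactants α ‖)

  Uniform : ∀ {m} → CRNet m → Set c
  Uniform R = ∀ {α β} → α ∈ R → β ∈ R →
              (order α ≡ order β) × (generativity α ≡ generativity β)

  sumF : List Carrier → Carrier
  sumF = List.foldr _+_ 0#

  prodF : ∀ {n} → Vec Carrier n → Carrier
  prodF = Vec.foldr _ _*_ 1#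

  fromℕ : ℕ → Carrier
  fromℕ zero = 0#
  fromℕ (suc n) = 1# + fromℕ n

  withReactants : ∀ {m} → CRNet m → Vec ℕ m → CRNet m
  withReactants R r = filter (λ α → reactants α ≟v r) R

  K : ∀ {m} → CRNet m → Vec ℕ m → Carrier
  K R r = sumF (map rate (withReactants R r))

  UniformlyReactive : ∀ {m} → CRNet m → Set (c ⊔ ℓ₁)
  UniformlyReactive {m} R =
    Uniform R × (∀ (r r′ : Vec ℕ m) → ‖ r ‖ ≡ ord R → ‖ r′ ‖ ≡ ord R →
                 K R r ≈ K R r′)

  -- v^{‖r‖-1} in the denominator, i.e. the factor k / v^{‖r‖-1}
  volumeFactor : Carrier → ℕ → Carrier
  volumeFactor v zero    = v                          -- k / v^{-1} = k v
  volumeFactor v (suc n) = (Vec.foldr _ _*_ 1# (Vec.replicate n v)) ⁻¹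

  propensity : ∀ {m} → Vec ℕ m → Carrier → Reaction m → Carrier
  propensity cfg v α =
    rate α * volumeFactor v (order α) *
    prodF (Vec.zipWith (λ cA rA → fromℕ (cA ^fall rA) * (fromℕ (rA ℕ.!)) ⁻¹)
                       cfg (reactants α))

  PrX : ∀ {m} → CRNet m → Carrier → Vec ℕ m → Vec ℕ m → Carrier
  PrX R v cfg r =
    sumF (map (propensity cfg v) (withReactants R r)) *
    (sumF (map (propensity cfg v) R)) ⁻¹

  molecules : ∀ {m} → Vec ℕ m → List (Fin m)
  molecules cfg = concat (Vec.toList (Vec.zipWith (λ A n → replicate n A)
                                                  (Vec.allFin _) cfg))

  select : ∀ {a} {X : Set a} → List X → List (X × List X)
  select [] = []
  select (x ∷ xs) = (x , xs) ∷ map (λ { (y , ys) → (y , x ∷ ys) }) (select xs)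

  -- all ordered draws of k elements without replacement (by position);
  -- these are the equally likely outcomes of the drawing process
  draws : ∀ {a} {X : Set a} → ℕ → List X → List (List X)
  draws zero xs = [] ∷ []
  draws (suc k) xs =
    concatMap (λ { (y , ys) → map (y ∷_) (draws k ys) }) (select xs)

  speciesCount : ∀ {m} → List (Fin m) → Vec ℕ m
  speciesCount d = Vec.map (λ A → length (filter (λ B → B Data.Fin.≟ A) d))
                           (Vec.allFin _)

  PrY : ∀ {m} → ℕ → Vec ℕ m → Vec ℕ m → Carrier
  PrY o cfg r =
    fromℕ (length (filter (λ d → speciesCount d ≟v r) (draws o (molecules cfg)))) *
    (fromℕ (length (draws o (molecules cfg)))) ⁻¹

-- Both probabilities are ratios of counts. Splitting an ordered draw of o molecules from c into
-- its first molecule and the rest shows, by induction on o, that exactly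
-- o! ∏_A c_A^{\underline{r_A}} / r_A! draws have species multiset r: o! times the
-- configuration-dependent factor of the propensity of any reaction with reactants r. As all
-- reactions have order o, the propensities of the reactions with reactants r therefore sum to a
-- fixed multiple of K(r) · #draws(r), and exchanging the two sums, all propensities sum to the same
-- multiple of Σ_d K(species of d) = K · #draws, because every draw has size o and K is constant on
-- vectors of size o. The factor cancels in both ratios.

module Submission where

open import Defs
open import Data.Nat using (ℕ; _≤_)
open import Data.List using (List; [])
open import Data.Vec using (Vec)
open import Relation.Binary.PropositionalEquality using (_≢_)

open import Relation.Binary.PropositionalEquality
  using (_≡_; _≗_; refl; sym; trans; cong; cong₂; subst; module ≡-Reasoning)
open import Relation.Nullary using (Dec; yes; no; does; contradiction)
open import Relation.Nullary.Decidable using (dec-true; dec-false)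
open import Data.Bool using (true; false; if_then_else_)
open import Data.Product using (_×_; _,_; proj₁; proj₂)
open import Function using (_∘_; id)
open import Relation.Unary using (_≐_)
open import Data.Fin using (Fin; zero; suc; _≟_)
open import Data.Fin.Properties using (punchInᵢ≢i)
open import Data.List as List using (_∷_; _++_; length; filter; map; concatMap; replicate; concat)
import Data.List.Properties as List
open import Data.Nat.ListAction using () renaming (sum to sumˡ)
open import Data.List.Relation.Unary.All as All using (All; []; _∷_)
open import Data.List.Relation.Unary.Any using (here)
import Data.List.Relation.Unary.All.Properties as All
import Data.Vec as V
import Data.Vec.Properties as VP

module Species where
  open import Data.Nat hiding (_≟_)
  open import Data.Nat.Properties hiding (_≟_)
  open import Algebra.Properties.Semiring.Sum +-*-semiring public
    using (sum; sum-cong-≗; sum-replicate-zero; ∑-distrib-+; *-distribˡ-sum; *-distribʳ-sum)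
  import Algebra.Properties.CommutativeMonoid.Sum *-1-commutativeMonoid as Product
  import Algebra.Properties.CommutativeSemigroup
  module +-Comm = Algebra.Properties.CommutativeSemigroup +-commutativeSemigroup
  module *-Comm = Algebra.Properties.CommutativeSemigroup *-commutativeSemigroup

  product : ∀ {m} → (Fin m → ℕ) → ℕ
  product = Product.sum

  product-cong : ∀ {m} {f g : Fin m → ℕ} → f ≗ g → product f ≡ product g
  product-cong = Product.sum-cong-≗

  product-scaleAt : ∀ {m} {f g : Fin m → ℕ} y x → f y ≡ x * g y →
                    (∀ B → B ≢ y → f B ≡ g B) → product f ≡ x * product g
  product-scaleAt {suc m} {f} {g} y x fy≡x*gy f≡g = begin
    product f                                    ≡⟨ Product.sum-remove f ⟩
    f y * product (f ∘ Data.Fin.punchIn y)       ≡⟨ cong₂ _*_ fy≡x*gy (Product.sum-cong-≗ (λ j → f≡g _ (punchInᵢ≢i y j))) ⟩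
    x * g y * product (g ∘ Data.Fin.punchIn y)   ≡⟨ *-assoc x (g y) _ ⟩
    x * (g y * product (g ∘ Data.Fin.punchIn y)) ≡⟨ cong (x *_) (Product.sum-remove g) ⟨
    x * product g                                ∎
    where open ≡-Reasoning

  δ : ∀ {m} → Fin m → Fin m → ℕ
  δ x A = if does (x ≟ A) then 1 else 0

  δ-refl : ∀ {m} (x : Fin m) → δ x x ≡ 1
  δ-refl x rewrite dec-true (x ≟ x) refl = refl

  δ-≢ : ∀ {m} {x A : Fin m} → x ≢ A → δ x A ≡ 0
  δ-≢ {x = x} {A} x≢A rewrite dec-false (x ≟ A) x≢A = refl

  δ-sym : ∀ {m} (x A : Fin m) → δ x A ≡ δ A x
  δ-sym x A with x ≟ A | A ≟ x
  ... | yes _   | yes _   = refl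
  ... | no _    | no _    = refl
  ... | yes x≡A | no A≢x  = contradiction (sym x≡A) A≢x
  ... | no x≢A  | yes A≡x = contradiction (sym A≡x) x≢A

  ∑-δ* : ∀ {m} (x : Fin m) (g : Fin m → ℕ) → sum (λ A → δ x A * g A) ≡ g x
  ∑-δ* {suc m} zero    g = trans (cong₂ _+_ (+-identityʳ (g zero)) (sum-replicate-zero m)) (+-identityʳ _)
  ∑-δ* {suc m} (suc x) g = ∑-δ* x (g ∘ suc)

  -- The multiset f with one copy of y removed; the lemmas below assume f y > 0, since ∸ truncates.
  decrementAt : ∀ {m} → Fin m → (Fin m → ℕ) → Fin m → ℕ
  decrementAt y f A = f A ∸ δ y A

  decrementAt-at : ∀ {m} y (f : Fin m → ℕ) → decrementAt y f y ≡ pred (f y)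
  decrementAt-at y f rewrite δ-refl y with f y
  ... | zero  = refl
  ... | suc _ = refl

  decrementAt-off : ∀ {m} {y B} (f : Fin m → ℕ) → B ≢ y → decrementAt y f B ≡ f B
  decrementAt-off f B≢y rewrite δ-≢ (B≢y ∘ sym) = refl

  δ+decrementAt : ∀ {m} y (f : Fin m → ℕ) {t} → f y ≡ suc t → ∀ A → δ y A + decrementAt y f A ≡ f A
  δ+decrementAt y f fy≡1+t A with y ≟ A
  ... | yes refl rewrite fy≡1+t = refl
  ... | no _     = refl

  decrementAt-δ+ : ∀ {m} y (f : Fin m → ℕ) {g} → (∀ A → f A ≡ δ y A + g A) → g ≗ decrementAt y f
  decrementAt-δ+ y f {g} f≡δ+g A = sym (trans (cong (_∸ δ y A) (f≡δ+g A)) (m+n∸m≡n (δ y A) (g A)))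

  sum≡0 : ∀ {m} (f : Fin m → ℕ) → sum f ≡ 0 → ∀ A → f A ≡ 0
  sum≡0 {suc m} f ∑f≡0 zero    = m+n≡0⇒m≡0 (f zero) ∑f≡0
  sum≡0 {suc m} f ∑f≡0 (suc A) = sum≡0 (f ∘ suc) (m+n≡0⇒n≡0 (f zero) ∑f≡0) A

  ∑-δ : ∀ {m} (x : Fin m) → sum (δ x) ≡ 1
  ∑-δ x = trans (sum-cong-≗ (λ A → sym (*-identityʳ (δ x A)))) (∑-δ* x (λ _ → 1))

  ∑-decrementAt : ∀ {m} y (f : Fin m → ℕ) {t} → f y ≡ suc t → sum f ≡ suc (sum (decrementAt y f))
  ∑-decrementAt y f fy≡1+t = begin
    sum f                                 ≡⟨ sum-cong-≗ (δ+decrementAt y f fy≡1+t) ⟨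
    sum (λ A → δ y A + decrementAt y f A) ≡⟨ ∑-distrib-+ (δ y) (decrementAt y f) ⟩
    sum (δ y) + sum (decrementAt y f)     ≡⟨ cong (_+ sum (decrementAt y f)) (∑-δ y) ⟩
    suc (sum (decrementAt y f))           ∎
    where open ≡-Reasoning

  product-ones : ∀ {m} {f : Fin m → ℕ} → (∀ A → f A ≡ 1) → product f ≡ 1
  product-ones {m} f≡1 = trans (product-cong f≡1) (Product.sum-replicate-zero m)

  product-pos : ∀ {m} {f : Fin m → ℕ} → (∀ A → 0 < f A) → 0 < product f
  product-pos {zero}  f>0 = z<s
  product-pos {suc m} f>0 = *-mono-≤ (f>0 zero) (product-pos (f>0 ∘ suc))

  ∏! : ∀ {m} → (Fin m → ℕ) → ℕ
  ∏! f = product (λ A → f A !)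

  ∏fall : ∀ {m} → (Fin m → ℕ) → (Fin m → ℕ) → ℕ
  ∏fall c r = product (λ A → c A ^fall r A)

  ∏!-pos : ∀ {m} (f : Fin m → ℕ) → 0 < ∏! f
  ∏!-pos f = product-pos (λ A → 1≤n! (f A))

  ∏!-cong : ∀ {m} {f g : Fin m → ℕ} → f ≗ g → ∏! f ≡ ∏! g
  ∏!-cong f≗g = product-cong (cong _! ∘ f≗g)

  ∏fall-cong : ∀ {m} {c c′ r r′ : Fin m → ℕ} → c ≗ c′ → r ≗ r′ → ∏fall c r ≡ ∏fall c′ r′
  ∏fall-cong c≗c′ r≗r′ = product-cong (λ A → cong₂ _^fall_ (c≗c′ A) (r≗r′ A))

  ∏!-decrementAt : ∀ {m} y (f : Fin m → ℕ) {t} → f y ≡ suc t → ∏! f ≡ suc t * ∏! (decrementAt y f)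
  ∏!-decrementAt y f {t} fy≡1+t = product-scaleAt y (suc t)
    (trans (cong _! fy≡1+t) (cong (λ n → suc t * n !) (sym (trans (decrementAt-at y f) (cong pred fy≡1+t)))))
    (λ B B≢y → cong _! (sym (decrementAt-off f B≢y)))

  ∏fall-decrementAt : ∀ {m} y (c r : Fin m → ℕ) {t} → r y ≡ suc t →
                ∏fall c r ≡ c y * ∏fall (decrementAt y c) (decrementAt y r)
  ∏fall-decrementAt y c r ry≡1+t = product-scaleAt y (c y)
    (trans (cong (c y ^fall_) ry≡1+t)
           (cong (c y *_) (sym (cong₂ _^fall_ (decrementAt-at y c) (trans (decrementAt-at y r) (cong pred ry≡1+t))))))
    (λ B B≢y → sym (cong₂ _^fall_ (decrementAt-off c B≢y) (decrementAt-off r B≢y)))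

  sumˡ-map-cong : ∀ {a} {X : Set a} {f g : X → ℕ} {xs} → All (λ x → f x ≡ g x) xs →
                  sumˡ (map f xs) ≡ sumˡ (map g xs)
  sumˡ-map-cong []             = refl
  sumˡ-map-cong (fx≡gx ∷ rest) = cong₂ _+_ fx≡gx (sumˡ-map-cong rest)

  sumˡ-map-*ʳ : ∀ {a} {X : Set a} (f : X → ℕ) k xs → sumˡ (map f xs) * k ≡ sumˡ (map (λ x → f x * k) xs)
  sumˡ-map-*ʳ f k []       = refl
  sumˡ-map-*ʳ f k (x ∷ xs) = trans (*-distribʳ-+ k (f x) _) (cong (_ +_) (sumˡ-map-*ʳ f k xs))

  count : ∀ {m} → List (Fin m) → Fin m → ℕ
  count xs A = length (filter (_≟ A) xs)

  count-∷ : ∀ {m} (x : Fin m) xs A → count (x ∷ xs) A ≡ δ x A + count xs A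
  count-∷ x xs A with does (x ≟ A)
  ... | true  = refl
  ... | false = refl

  count-++ : ∀ {m} (xs ys : List (Fin m)) A → count (xs ++ ys) A ≡ count xs A + count ys A
  count-++ xs ys A = trans (cong length (List.filter-++ (_≟ A) xs ys)) (List.length-++ (filter (_≟ A) xs))

  count-replicate : ∀ {m} n (B A : Fin m) → count (replicate n B) A ≡ n * δ B A
  count-replicate zero    B A = refl
  count-replicate (suc n) B A = trans (count-∷ B (replicate n B) A) (cong (δ B A +_) (count-replicate n B A))

  sumˡ-map-by-count : ∀ {m} (g : Fin m → ℕ) xs → sumˡ (map g xs) ≡ sum (λ A → count xs A * g A)
  sumˡ-map-by-count {m} g []       = sym (sum-replicate-zero m)
  sumˡ-map-by-count     g (x ∷ xs) = begin
    g x + sumˡ (map g xs)                                  ≡⟨ cong₂ _+_ (sym (∑-δ* x g)) (sumˡ-map-by-count g xs) ⟩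
    sum (λ A → δ x A * g A) + sum (λ A → count xs A * g A) ≡⟨ ∑-distrib-+ (λ A → δ x A * g A) (λ A → count xs A * g A) ⟨
    sum (λ A → δ x A * g A + count xs A * g A)             ≡⟨ sum-cong-≗ (λ A → sym (*-distribʳ-+ (g A) (δ x A) _)) ⟩
    sum (λ A → (δ x A + count xs A) * g A)                 ≡⟨ sum-cong-≗ (λ A → cong (_* g A) (count-∷ x xs A)) ⟨
    sum (λ A → count (x ∷ xs) A * g A)                     ∎
    where open ≡-Reasoning

  length-by-count : ∀ {m} (xs : List (Fin m)) → length xs ≡ sum (count xs)
  length-by-count xs = begin
    length xs                  ≡⟨ length≡sumˡ-ones xs ⟩
    sumˡ (map (λ _ → 1) xs)    ≡⟨ sumˡ-map-by-count (λ _ → 1) xs ⟩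
    sum (λ A → count xs A * 1) ≡⟨ sum-cong-≗ (λ A → *-identityʳ (count xs A)) ⟩
    sum (count xs)             ∎
    where
    open ≡-Reasoning
    length≡sumˡ-ones : ∀ {a} {X : Set a} (xs : List X) → length xs ≡ sumˡ (map (λ _ → 1) xs)
    length≡sumˡ-ones []       = refl
    length≡sumˡ-ones (_ ∷ xs) = cong suc (length≡sumˡ-ones xs)

module _ {a p} {X : Set a} {P : X → Set p} (P? : (x : X) → Dec (P x)) where
  open import Data.Nat using (suc; _+_)

  length-filter-map : ∀ {b} {Y : Set b} (f : Y → X) ys →
                      length (filter P? (map f ys)) ≡ length (filter (P? ∘ f) ys)
  length-filter-map f []       = refl
  length-filter-map f (y ∷ ys) with does (P? (f y))
  ... | true  = cong suc (length-filter-map f ys)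
  ... | false = length-filter-map f ys

  length-filter-concatMap : ∀ {b} {Y : Set b} (f : Y → List X) ys →
    length (filter P? (concatMap f ys)) ≡ sumˡ (map (length ∘ filter P? ∘ f) ys)
  length-filter-concatMap f []       = refl
  length-filter-concatMap f (y ∷ ys) = begin
    length (filter P? (f y ++ concatMap f ys))                     ≡⟨ cong length (List.filter-++ P? (f y) _) ⟩
    length (filter P? (f y) ++ filter P? (concatMap f ys))         ≡⟨ List.length-++ (filter P? (f y)) ⟩
    length (filter P? (f y)) + length (filter P? (concatMap f ys)) ≡⟨ cong (_ +_) (length-filter-concatMap f ys) ⟩
    length (filter P? (f y)) + sumˡ (map (length ∘ filter P? ∘ f) ys) ∎
    where open ≡-Reasoning

module Sampling {c ℓ₁ ℓ₂} (F : OrderedField c ℓ₁ ℓ₂) where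
  open CRN F using (molecules; select; draws; speciesCount)
  open Species
  open import Data.Nat hiding (_≟_)
  open import Data.Nat.Properties hiding (_≟_)
  open V using (lookup; tabulate)

  speciesCount-tabulate : ∀ {m} (d : List (Fin m)) → speciesCount d ≡ tabulate (count d)
  speciesCount-tabulate d = sym (VP.tabulate-∘ (count d) id)

  lookup-speciesCount : ∀ {m} (d : List (Fin m)) A → lookup (speciesCount d) A ≡ count d A
  lookup-speciesCount d A = trans (cong (λ v → lookup v A) (speciesCount-tabulate d)) (VP.lookup∘tabulate (count d) A)

  speciesCount-≡ : ∀ {m} {d : List (Fin m)} {r} → count d ≗ lookup r → speciesCount d ≡ r
  speciesCount-≡ {d = d} {r} d≗r =
    trans (speciesCount-tabulate d) (trans (VP.tabulate-cong d≗r) (VP.tabulate∘lookup r))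

  ‖‖-as-sum : ∀ {m} (r : Vec ℕ m) → ‖ r ‖ ≡ sum (lookup r)
  ‖‖-as-sum V.[]      = refl
  ‖‖-as-sum (x V.∷ r) = cong (x +_) (‖‖-as-sum r)

  ‖speciesCount‖ : ∀ {m} (d : List (Fin m)) → ‖ speciesCount d ‖ ≡ length d
  ‖speciesCount‖ d = begin
    ‖ speciesCount d ‖            ≡⟨ ‖‖-as-sum (speciesCount d) ⟩
    sum (lookup (speciesCount d)) ≡⟨ sum-cong-≗ (lookup-speciesCount d) ⟩
    sum (count d)                 ≡⟨ length-by-count d ⟨
    length d                      ∎
    where open ≡-Reasoning

  count-molecules : ∀ {m} (cfg : Vec ℕ m) A → count (molecules cfg) A ≡ lookup cfg A
  count-molecules cfg A = begin
    count (molecules cfg) A          ≡⟨ count-blocks id cfg ⟩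
    sum (λ B → δ B A * lookup cfg B) ≡⟨ sum-cong-≗ (λ B → cong (_* lookup cfg B) (δ-sym B A)) ⟩
    sum (λ B → δ A B * lookup cfg B) ≡⟨ ∑-δ* A (lookup cfg) ⟩
    lookup cfg A                     ∎
    where
    open ≡-Reasoning
    count-blocks : ∀ {k} (g : Fin k → Fin _) (c : Vec ℕ k) →
      count (concat (V.toList (V.zipWith (λ B n → replicate n B) (tabulate g) c))) A
        ≡ sum (λ B → δ (g B) A * lookup c B)
    count-blocks g V.[]      = refl
    count-blocks g (n V.∷ c) = trans (count-++ (replicate n (g zero)) _ A)
      (cong₂ _+_ (trans (count-replicate n (g zero) A) (*-comm n _)) (count-blocks (g ∘ suc) c))

  length-molecules : ∀ {m} (cfg : Vec ℕ m) → length (molecules cfg) ≡ ‖ cfg ‖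
  length-molecules cfg = begin
    length (molecules cfg)      ≡⟨ length-by-count (molecules cfg) ⟩
    sum (count (molecules cfg)) ≡⟨ sum-cong-≗ (count-molecules cfg) ⟩
    sum (lookup cfg)            ≡⟨ ‖‖-as-sum cfg ⟨
    ‖ cfg ‖                     ∎
    where open ≡-Reasoning

  Picks : ∀ {m} → List (Fin m) → Fin m × List (Fin m) → Set
  Picks xs (y , ys) = ∀ A → count xs A ≡ δ y A + count ys A

  select-picks : ∀ {m} (xs : List (Fin m)) → All (Picks xs) (select xs)
  select-picks []       = []
  select-picks (x ∷ xs) = count-∷ x xs ∷ All.map⁺ (All.map (λ {p} → keep-x p) (select-picks xs))
    where
    keep-x : ∀ p → Picks xs p → Picks (x ∷ xs) (proj₁ p , x ∷ proj₂ p)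
    keep-x (y , ys) xs≡y+ys A rewrite count-∷ x xs A | count-∷ x ys A | xs≡y+ys A =
      +-Comm.x∙yz≈y∙xz (δ x A) (δ y A) (count ys A)

  map-proj₁-select : ∀ {a} {X : Set a} (xs : List X) → map proj₁ (select xs) ≡ xs
  map-proj₁-select []       = refl
  map-proj₁-select (x ∷ xs) = cong (x ∷_) (trans (sym (List.map-∘ (select xs))) (map-proj₁-select xs))

  draws-length : ∀ {a} {X : Set a} k (xs : List X) → All (λ d → length d ≡ k) (draws k xs)
  draws-length zero    xs = refl ∷ []
  draws-length (suc k) xs = All.concat⁺ (All.map⁺ {xs = select xs} {f = λ p → map (proj₁ p ∷_) (draws k (proj₂ p))}
    (All.tabulate λ {p} _ → All.map⁺ (All.map (cong suc) (draws-length k (proj₂ p)))))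

  draws-nonempty : ∀ {a} {X : Set a} k (xs : List X) → k ≤ length xs → 0 < length (draws k xs)
  draws-nonempty zero    xs       _         = s≤s z≤n
  draws-nonempty (suc k) (x ∷ xs) (s≤s k≤n) = begin-strict
    0                                    <⟨ draws-nonempty k xs k≤n ⟩
    length (draws k xs)                  ≡⟨ List.length-map (x ∷_) (draws k xs) ⟨
    length (map (x ∷_) (draws k xs))     ≤⟨ m≤m+n _ _ ⟩
    length (map (x ∷_) (draws k xs)) + _ ≡⟨ List.length-++ (map (x ∷_) (draws k xs)) ⟨
    length (draws (suc k) (x ∷ xs))      ∎
    where open ≤-Reasoning

  #draws : ∀ {m} → ℕ → List (Fin m) → Vec ℕ m → ℕ
  #draws k xs r = length (filter (λ d → speciesCount d ≟v r) (draws k xs))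

  speciesCount-∷-zero : ∀ {m} {y} {r : Vec ℕ m} → lookup r y ≡ 0 → ∀ d → speciesCount (y ∷ d) ≢ r
  speciesCount-∷-zero {y = y} ry≡0 d y∷d≡r = 1+n≢0 (begin
    suc (count d y)                 ≡⟨ cong (_+ count d y) (δ-refl y) ⟨
    δ y y + count d y               ≡⟨ count-∷ y d y ⟨
    count (y ∷ d) y                 ≡⟨ lookup-speciesCount (y ∷ d) y ⟨
    lookup (speciesCount (y ∷ d)) y ≡⟨ cong (λ v → lookup v y) y∷d≡r ⟩
    _                               ≡⟨ ry≡0 ⟩
    0                               ∎)
    where open ≡-Reasoning

  speciesCount-∷-suc : ∀ {m} {y} {r : Vec ℕ m} {t} → lookup r y ≡ suc t →
    (λ d → speciesCount (y ∷ d) ≡ r) ≐ (λ d → speciesCount d ≡ tabulate (decrementAt y (lookup r)))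
  speciesCount-∷-suc {y = y} {r} ry≡1+t = forth , back
    where
    forth : ∀ {d} → speciesCount (y ∷ d) ≡ r → speciesCount d ≡ tabulate (decrementAt y (lookup r))
    forth {d} y∷d≡r = speciesCount-≡ {d = d} λ A → trans (decrementAt-δ+ y (lookup r) {count d} (λ B → begin
        lookup r B                      ≡⟨ cong (λ v → lookup v B) y∷d≡r ⟨
        lookup (speciesCount (y ∷ d)) B ≡⟨ lookup-speciesCount (y ∷ d) B ⟩
        count (y ∷ d) B                 ≡⟨ count-∷ y d B ⟩
        δ y B + count d B               ∎) A) (sym (VP.lookup∘tabulate _ A))
      where open ≡-Reasoning
    back : ∀ {d} → speciesCount d ≡ tabulate (decrementAt y (lookup r)) → speciesCount (y ∷ d) ≡ r
    back {d} d≡r′ = speciesCount-≡ {d = y ∷ d} λ A → begin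
      count (y ∷ d) A                                        ≡⟨ count-∷ y d A ⟩
      δ y A + count d A                                      ≡⟨ cong (δ y A +_) (lookup-speciesCount d A) ⟨
      δ y A + lookup (speciesCount d) A                      ≡⟨ cong (λ v → δ y A + lookup v A) d≡r′ ⟩
      δ y A + lookup (tabulate (decrementAt y (lookup r))) A ≡⟨ cong (δ y A +_) (VP.lookup∘tabulate _ A) ⟩
      δ y A + decrementAt y (lookup r) A                     ≡⟨ δ+decrementAt y (lookup r) ry≡1+t A ⟩
      lookup r A                                             ∎
      where open ≡-Reasoning

  #draws-headed : ∀ {m} k xs y ys → Picks xs (y , ys) →
    (∀ (r′ : Vec ℕ m) → ‖ r′ ‖ ≡ k → #draws k ys r′ * ∏! (lookup r′) ≡ k ! * ∏fall (count ys) (lookup r′)) →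
    ∀ r → ‖ r ‖ ≡ suc k →
    length (filter (λ d → speciesCount d ≟v r) (map (y ∷_) (draws k ys))) * ∏! (lookup r)
      ≡ lookup r y * (k ! * ∏fall (decrementAt y (count xs)) (decrementAt y (lookup r)))
  #draws-headed k xs y ys xs≡y+ys ih r ‖r‖≡1+k with lookup r y in ry
  ... | zero  = cong (_* ∏! (lookup r))
    (trans (length-filter-map P? (y ∷_) (draws k ys))
           (cong length (List.filter-none (P? ∘ (y ∷_)) {draws k ys} (All.tabulate λ {d} _ → speciesCount-∷-zero ry d))))
    where
    P? : (d : List (Fin _)) → Dec (speciesCount d ≡ r)
    P? d = speciesCount d ≟v r
  ... | suc t = begin
    length (filter P? (map (y ∷_) (draws k ys))) * ∏! (lookup r)
                                                   ≡⟨ cong₂ _*_ heads≡ ∏!r≡ ⟩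
    #draws k ys r′ * (suc t * ∏! (lookup r′))    ≡⟨ *-Comm.x∙yz≈y∙xz (#draws k ys r′) (suc t) _ ⟩
    suc t * (#draws k ys r′ * ∏! (lookup r′))    ≡⟨ cong (suc t *_) (ih r′ ‖r′‖≡k) ⟩
    suc t * (k ! * ∏fall (count ys) (lookup r′)) ≡⟨ cong (λ n → suc t * (k ! * n)) ∏fall≡ ⟩
    suc t * (k ! * ∏fall (decrementAt y (count xs)) (decrementAt y (lookup r))) ∎
    where
    open ≡-Reasoning
    P? : (d : List (Fin _)) → Dec (speciesCount d ≡ r)
    P? d = speciesCount d ≟v r
    r′ : Vec ℕ _
    r′ = tabulate (decrementAt y (lookup r))
    lookup-r′ : lookup r′ ≗ decrementAt y (lookup r)
    lookup-r′ = VP.lookup∘tabulate (decrementAt y (lookup r))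
    ∏!r≡ : ∏! (lookup r) ≡ suc t * ∏! (lookup r′)
    ∏!r≡ = trans (∏!-decrementAt y (lookup r) ry) (cong (suc t *_) (∏!-cong (sym ∘ lookup-r′)))
    ∏fall≡ : ∏fall (count ys) (lookup r′) ≡ ∏fall (decrementAt y (count xs)) (decrementAt y (lookup r))
    ∏fall≡ = ∏fall-cong (decrementAt-δ+ y (count xs) xs≡y+ys) lookup-r′
    heads≡ : length (filter P? (map (y ∷_) (draws k ys))) ≡ #draws k ys r′
    heads≡ = trans (length-filter-map P? (y ∷_) (draws k ys))
                   (cong length (List.filter-≐ (P? ∘ (y ∷_)) (λ d → speciesCount d ≟v r′)
                                               (speciesCount-∷-suc ry) (draws k ys)))
    ‖r′‖≡k : ‖ r′ ‖ ≡ k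
    ‖r′‖≡k = suc-injective (begin
      suc ‖ r′ ‖                           ≡⟨ cong suc (trans (‖‖-as-sum r′) (sum-cong-≗ lookup-r′)) ⟩
      suc (sum (decrementAt y (lookup r))) ≡⟨ ∑-decrementAt y (lookup r) ry ⟨
      sum (lookup r)                       ≡⟨ ‖‖-as-sum r ⟨
      ‖ r ‖                                ≡⟨ ‖r‖≡1+k ⟩
      suc k                                ∎)

  ∏fall-decrementAt-weighted : ∀ {m} k (c r : Fin m → ℕ) A →
    c A * (r A * (k ! * ∏fall (decrementAt A c) (decrementAt A r))) ≡ k ! * (r A * ∏fall c r)
  ∏fall-decrementAt-weighted k c r A with r A in rA
  ... | zero  = trans (*-zeroʳ (c A)) (sym (*-zeroʳ (k !)))
  ... | suc t = begin
    c A * (suc t * (k ! * Π′)) ≡⟨ *-Comm.x∙yz≈y∙xz (c A) (suc t) _ ⟩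
    suc t * (c A * (k ! * Π′)) ≡⟨ cong (suc t *_) (*-Comm.x∙yz≈y∙xz (c A) (k !) Π′) ⟩
    suc t * (k ! * (c A * Π′)) ≡⟨ *-Comm.x∙yz≈y∙xz (suc t) (k !) _ ⟩
    k ! * (suc t * (c A * Π′)) ≡⟨ cong (λ n → k ! * (suc t * n)) (∏fall-decrementAt A c r rA) ⟨
    k ! * (suc t * ∏fall c r)  ∎
    where
    open ≡-Reasoning
    Π′ : ℕ
    Π′ = ∏fall (decrementAt A c) (decrementAt A r)

  #draws-multinomial : ∀ {m} k xs (r : Vec ℕ m) → ‖ r ‖ ≡ k →
                       #draws k xs r * ∏! (lookup r) ≡ k ! * ∏fall (count xs) (lookup r)
  #draws-multinomial zero xs r ‖r‖≡0 =
    trans (cong₂ _*_ single-draw (product-ones (cong _! ∘ r≡0)))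
          (sym (trans (*-identityˡ _) (product-ones (λ A → cong (count xs A ^fall_) (r≡0 A)))))
    where
    r≡0 : ∀ A → lookup r A ≡ 0
    r≡0 = sum≡0 (lookup r) (trans (sym (‖‖-as-sum r)) ‖r‖≡0)
    single-draw : #draws 0 xs r ≡ 1
    single-draw rewrite dec-true (speciesCount [] ≟v r) (speciesCount-≡ {d = []} (sym ∘ r≡0)) = refl
  #draws-multinomial (suc k) xs r ‖r‖≡1+k = begin
    #draws (suc k) xs r * ∏! (lookup r)
      ≡⟨ cong (_* ∏! (lookup r)) (length-filter-concatMap P? headed (select xs)) ⟩
    sumˡ (map (length ∘ filter P? ∘ headed) (select xs)) * ∏! (lookup r)
      ≡⟨ sumˡ-map-*ʳ (length ∘ filter P? ∘ headed) (∏! (lookup r)) (select xs) ⟩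
    sumˡ (map (λ p → length (filter P? (headed p)) * ∏! (lookup r)) (select xs))
      ≡⟨ sumˡ-map-cong (All.map (λ {p} picks → #draws-headed k xs (proj₁ p) (proj₂ p) picks
                                    (λ r′ → #draws-multinomial k (proj₂ p) r′) r ‖r‖≡1+k)
                                 (select-picks xs)) ⟩
    sumˡ (map (G ∘ proj₁) (select xs))
      ≡⟨ cong sumˡ (trans (List.map-∘ (select xs)) (cong (map G) (map-proj₁-select xs))) ⟩
    sumˡ (map G xs)                    ≡⟨ sumˡ-map-by-count G xs ⟩
    sum (λ A → count xs A * G A)       ≡⟨ sum-cong-≗ (∏fall-decrementAt-weighted k (count xs) (lookup r)) ⟩
    sum (λ A → k ! * (lookup r A * Π)) ≡⟨ *-distribˡ-sum (k !) (λ A → lookup r A * Π) ⟨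
    k ! * sum (λ A → lookup r A * Π)   ≡⟨ cong (k ! *_) (*-distribʳ-sum Π (lookup r)) ⟨
    k ! * (sum (lookup r) * Π)         ≡⟨ cong (λ n → k ! * (n * Π)) (trans (sym (‖‖-as-sum r)) ‖r‖≡1+k) ⟩
    k ! * (suc k * Π)                  ≡⟨ *-Comm.x∙yz≈yx∙z (k !) (suc k) Π ⟩
    suc k ! * Π                        ∎
    where
    open ≡-Reasoning
    P? : (d : List (Fin _)) → Dec (speciesCount d ≡ r)
    P? d = speciesCount d ≟v r
    headed : Fin _ × List (Fin _) → List (List (Fin _))
    headed p = map (proj₁ p ∷_) (draws k (proj₂ p))
    G : Fin _ → ℕ
    G y = lookup r y * (k ! * ∏fall (decrementAt y (count xs)) (decrementAt y (lookup r)))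
    Π : ℕ
    Π = ∏fall (count xs) (lookup r)

module FieldArithmetic {c ℓ₁ ℓ₂} (F : OrderedField c ℓ₁ ℓ₂) where
  open OrderedField F
  open CRN F using (sumF; fromℕ)
  open import Algebra.Bundles using (CommutativeRing)
  open import Relation.Binary.Structures using (IsStrictTotalOrder)
  import Data.Nat as ℕ

  commutativeRing : CommutativeRing c ℓ₁
  commutativeRing = record { isCommutativeRing = isCommutativeRing }

  open CommutativeRing commutativeRing public
    using (_≉_; setoid; *-cong; +-cong; *-congˡ; *-congʳ; +-congˡ; +-congʳ; *-assoc; *-comm;
           *-identityˡ; *-identityʳ; +-identityˡ; +-identityʳ; zeroˡ; zeroʳ; distribˡ; distribʳ;
           *-commutativeMonoid; +-commutativeSemigroup)
    renaming (refl to ≈-refl; sym to ≈-sym; trans to ≈-trans; reflexive to ≈-reflexive)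
  open IsStrictTotalOrder isStrictTotalOrder using (irrefl; <-respʳ-≈; <-respˡ-≈) renaming (trans to <-trans)
  open import Relation.Binary.Reasoning.Setoid setoid
  open import Algebra.Properties.CommutativeSemigroup +-commutativeSemigroup using () renaming (interchange to +-interchange)
  open import Algebra.Properties.Semiring.Mult (CommutativeRing.semiring commutativeRing) using (×1-homo-*) renaming (_×_ to _×ₙ_)
  import Relation.Binary.PropositionalEquality as ≡

  pos⇒≉0 : ∀ {x} → 0# < x → x ≉ 0#
  pos⇒≉0 0<x x≈0 = irrefl (≈-sym x≈0) 0<x

  *-≉0 : ∀ {x y} → x ≉ 0# → y ≉ 0# → x * y ≉ 0#
  *-≉0 {x} {y} x≉0 y≉0 xy≈0 = y≉0 (begin
    y              ≈⟨ *-identityˡ y ⟨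
    1# * y         ≈⟨ *-congʳ (≈-trans (*-comm (x ⁻¹) x) (*-inverse x x≉0)) ⟨
    x ⁻¹ * x * y   ≈⟨ *-assoc _ x y ⟩
    x ⁻¹ * (x * y) ≈⟨ *-congˡ xy≈0 ⟩
    x ⁻¹ * 0#      ≈⟨ zeroʳ _ ⟩
    0#             ∎)

  ⁻¹-≉0 : ∀ {x} → x ≉ 0# → x ⁻¹ ≉ 0#
  ⁻¹-≉0 {x} x≉0 x⁻¹≈0 = pos⇒≉0 0<1 (begin
    1#       ≈⟨ *-inverse x x≉0 ⟨
    x * x ⁻¹ ≈⟨ *-congˡ x⁻¹≈0 ⟩
    x * 0#   ≈⟨ zeroʳ x ⟩
    0#       ∎)

  *-cancelʳ : ∀ {x y z} → z ≉ 0# → x * z ≈ y * z → x ≈ y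
  *-cancelʳ {x} {y} {z} z≉0 xz≈yz = begin
    x              ≈⟨ *-identityʳ x ⟨
    x * 1#         ≈⟨ *-congˡ (*-inverse z z≉0) ⟨
    x * (z * z ⁻¹) ≈⟨ *-assoc x z _ ⟨
    x * z * z ⁻¹   ≈⟨ *-congʳ xz≈yz ⟩
    y * z * z ⁻¹   ≈⟨ *-assoc y z _ ⟩
    y * (z * z ⁻¹) ≈⟨ *-congˡ (*-inverse z z≉0) ⟩
    y * 1#         ≈⟨ *-identityʳ y ⟩
    y              ∎

  *-⁻¹-cross : ∀ {x y z w} → y ≉ 0# → w ≉ 0# → x * w ≈ z * y → x * y ⁻¹ ≈ z * w ⁻¹
  *-⁻¹-cross {x} {y} {z} {w} y≉0 w≉0 xw≈zy = *-cancelʳ (*-≉0 y≉0 w≉0) (begin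
    x * y ⁻¹ * (y * w) ≈⟨ solve 4 (λ x y′ y w → (x ⊕ y′) ⊕ (y ⊕ w) ⊜ (x ⊕ w) ⊕ (y ⊕ y′)) ≈-refl x (y ⁻¹) y w ⟩
    x * w * (y * y ⁻¹) ≈⟨ *-cong xw≈zy (*-inverse y y≉0) ⟩
    z * y * 1#         ≈⟨ *-congˡ (*-inverse w w≉0) ⟨
    z * y * (w * w ⁻¹) ≈⟨ solve 4 (λ z y w w′ → (z ⊕ y) ⊕ (w ⊕ w′) ⊜ (z ⊕ w′) ⊕ (y ⊕ w)) ≈-refl z y w (w ⁻¹) ⟩
    z * w ⁻¹ * (y * w) ∎)
    where open import Algebra.Solver.CommutativeMonoid *-commutativeMonoid using (solve; _⊕_; _⊜_)

  +-pos : ∀ {x y} → 0# < x → 0# < y → 0# < x + y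
  +-pos {x} {y} 0<x 0<y = <-trans 0<y (<-respˡ-≈ (+-identityˡ y) (+-monoˡ-< y 0<x))

  fromℕ≡×1 : ∀ n → fromℕ n ≡ n ×ₙ 1#
  fromℕ≡×1 ℕ.zero    = ≡.refl
  fromℕ≡×1 (ℕ.suc n) = ≡.cong (1# +_) (fromℕ≡×1 n)

  fromℕ-* : ∀ m n → fromℕ (m ℕ.* n) ≈ fromℕ m * fromℕ n
  fromℕ-* m n rewrite fromℕ≡×1 (m ℕ.* n) | fromℕ≡×1 m | fromℕ≡×1 n = ×1-homo-* m n

  fromℕ-pos : ∀ n → 0# < fromℕ (ℕ.suc n)
  fromℕ-pos ℕ.zero    = <-respʳ-≈ (≈-sym (+-identityʳ 1#)) 0<1
  fromℕ-pos (ℕ.suc n) = +-pos 0<1 (fromℕ-pos n)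

  fromℕ-≉0 : ∀ {n} → 0 ℕ.< n → fromℕ n ≉ 0#
  fromℕ-≉0 {ℕ.suc n} _ = pos⇒≉0 (fromℕ-pos n)

  module _ {a} {X : Set a} where
    sumF-cong : ∀ {f g : X → Carrier} {xs} → All (λ x → f x ≈ g x) xs → sumF (map f xs) ≈ sumF (map g xs)
    sumF-cong []             = ≈-refl
    sumF-cong (fx≈gx ∷ rest) = +-cong fx≈gx (sumF-cong rest)

    sumF-*ˡ : ∀ k (f : X → Carrier) xs → k * sumF (map f xs) ≈ sumF (map (λ x → k * f x) xs)
    sumF-*ˡ k f []       = zeroʳ k
    sumF-*ˡ k f (x ∷ xs) = ≈-trans (distribˡ k (f x) _) (+-congˡ (sumF-*ˡ k f xs))

    sumF-*ʳ : ∀ k (f : X → Carrier) xs → sumF (map f xs) * k ≈ sumF (map (λ x → f x * k) xs)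
    sumF-*ʳ k f []       = zeroˡ k
    sumF-*ʳ k f (x ∷ xs) = ≈-trans (distribʳ k (f x) _) (+-congˡ (sumF-*ʳ k f xs))

    sumF-+ : ∀ (f g : X → Carrier) xs → sumF (map (λ x → f x + g x) xs) ≈ sumF (map f xs) + sumF (map g xs)
    sumF-+ f g []       = ≈-sym (+-identityˡ 0#)
    sumF-+ f g (x ∷ xs) = ≈-trans (+-congˡ (sumF-+ f g xs)) (+-interchange (f x) (g x) _ _)

    sumF-zeros : ∀ xs → sumF (map (λ (_ : X) → 0#) xs) ≈ 0#
    sumF-zeros []       = ≈-refl
    sumF-zeros (_ ∷ xs) = ≈-trans (+-congˡ (sumF-zeros xs)) (+-identityˡ 0#)

    sumF-const : ∀ k xs → sumF (map (λ (_ : X) → k) xs) ≈ fromℕ (length xs) * k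
    sumF-const k []       = ≈-sym (zeroˡ k)
    sumF-const k (x ∷ xs) = begin
      k + sumF (map (λ _ → k) xs)    ≈⟨ +-cong (≈-sym (*-identityˡ k)) (sumF-const k xs) ⟩
      1# * k + fromℕ (length xs) * k ≈⟨ distribʳ k 1# _ ⟨
      fromℕ (length (x ∷ xs)) * k    ∎

    sumF-pos : ∀ (f : X → Carrier) {x xs} → All (λ y → 0# < f y) (x ∷ xs) → 0# < sumF (map f (x ∷ xs))
    sumF-pos f {xs = []}     (0<fx ∷ [])   = <-respʳ-≈ (≈-sym (+-identityʳ _)) 0<fx
    sumF-pos f {xs = _ ∷ _}  (0<fx ∷ rest) = +-pos 0<fx (sumF-pos f rest)

  sumF-swap : ∀ {a b} {X : Set a} {Y : Set b} (f : X → Y → Carrier) xs ys →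
    sumF (map (λ x → sumF (map (f x) ys)) xs) ≈ sumF (map (λ y → sumF (map (λ x → f x y) xs)) ys)
  sumF-swap f []       ys = ≈-sym (sumF-zeros ys)
  sumF-swap f (x ∷ xs) ys = ≈-trans (+-congˡ (sumF-swap f xs ys)) (≈-sym (sumF-+ (f x) _ ys))

  indicator : ∀ {p} {P : Set p} → Dec P → Carrier
  indicator P? = if does P? then 1# else 0#

  fromℕ-length-filter : ∀ {a p} {X : Set a} {P : X → Set p} (P? : ∀ x → Dec (P x)) xs →
    fromℕ (length (filter P? xs)) ≈ sumF (map (indicator ∘ P?) xs)
  fromℕ-length-filter P? []       = ≈-refl
  fromℕ-length-filter P? (x ∷ xs) with does (P? x)
  ... | true  = +-congˡ (fromℕ-length-filter P? xs)
  ... | false = ≈-trans (fromℕ-length-filter P? xs) (≈-sym (+-identityˡ _))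

module Gillespie {c ℓ₁ ℓ₂} (F : OrderedField c ℓ₁ ℓ₂) where
  open OrderedField F
  open CRN F
  open Species using (∏!; ∏fall; count)
  open Sampling F
  open FieldArithmetic F
  open import Relation.Binary.Reasoning.Setoid setoid
  import Data.Nat as ℕ
  import Data.Nat.Properties as ℕ
  import Relation.Binary.PropositionalEquality as ≡
  open V using (lookup)

  -- ∏_A binom(c_A, r_A), the factor of the propensity that depends on the configuration
  reactantChoices : ∀ {m} → Vec ℕ m → Vec ℕ m → Carrier
  reactantChoices cfg r = prodF (V.zipWith (λ cA rA → fromℕ (cA ^fall rA) * (fromℕ (rA ℕ.!)) ⁻¹) cfg r)

  reactantChoices-* : ∀ {m} (cfg r : Vec ℕ m) →
    reactantChoices cfg r * fromℕ (∏! (lookup r)) ≈ fromℕ (∏fall (lookup cfg) (lookup r))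
  reactantChoices-* V.[]        V.[]      = *-identityˡ _
  reactantChoices-* (a V.∷ cfg) (b V.∷ r) = begin
    (A * B ⁻¹) * Q * fromℕ (b ℕ.! ℕ.* ∏! (lookup r))
      ≈⟨ *-congˡ (fromℕ-* (b ℕ.!) _) ⟩
    (A * B ⁻¹) * Q * (B * D)
      ≈⟨ solve 5 (λ A B′ Q B D → ((A ⊕ B′) ⊕ Q) ⊕ (B ⊕ D) ⊜ (A ⊕ (B ⊕ B′)) ⊕ (Q ⊕ D)) ≈-refl A (B ⁻¹) Q B D ⟩
    (A * (B * B ⁻¹)) * (Q * D)
      ≈⟨ *-cong (≈-trans (*-congˡ (*-inverse B (fromℕ-≉0 (ℕ.1≤n! b)))) (*-identityʳ A)) (reactantChoices-* cfg r) ⟩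
    A * fromℕ (∏fall (lookup cfg) (lookup r))
      ≈⟨ fromℕ-* (a ^fall b) _ ⟨
    fromℕ (∏fall (lookup (a V.∷ cfg)) (lookup (b V.∷ r))) ∎
    where
    open import Algebra.Solver.CommutativeMonoid *-commutativeMonoid using (solve; _⊕_; _⊜_)
    A B Q D : Carrier
    A = fromℕ (a ^fall b)
    B = fromℕ (b ℕ.!)
    Q = reactantChoices cfg r
    D = fromℕ (∏! (lookup r))

  reactantChoices-draws : ∀ {m} (cfg r : Vec ℕ m) {o} → ‖ r ‖ ≡ o →
    fromℕ (o ℕ.!) * reactantChoices cfg r ≈ fromℕ (#draws o (molecules cfg) r)
  reactantChoices-draws cfg r {o} ‖r‖≡o = *-cancelʳ (fromℕ-≉0 (Species.∏!-pos (lookup r))) (begin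
    fromℕ (o ℕ.!) * Q * D                                 ≈⟨ *-assoc _ Q D ⟩
    fromℕ (o ℕ.!) * (Q * D)                               ≈⟨ *-congˡ (reactantChoices-* cfg r) ⟩
    fromℕ (o ℕ.!) * fromℕ (∏fall (lookup cfg) (lookup r)) ≈⟨ fromℕ-* (o ℕ.!) _ ⟨
    fromℕ (o ℕ.! ℕ.* ∏fall (lookup cfg) (lookup r))       ≡⟨ ≡.cong fromℕ multinomial ⟨
    fromℕ (N ℕ.* ∏! (lookup r))                           ≈⟨ fromℕ-* N _ ⟩
    fromℕ N * D                                           ∎)
    where
    Q D : Carrier
    Q = reactantChoices cfg r
    D = fromℕ (∏! (lookup r))
    N : ℕ
    N = #draws o (molecules cfg) r
    multinomial : N ℕ.* ∏! (lookup r) ≡ o ℕ.! ℕ.* ∏fall (lookup cfg) (lookup r)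
    multinomial = ≡.trans (#draws-multinomial o (molecules cfg) r ‖r‖≡o)
                          (≡.cong (o ℕ.! ℕ.*_) (Species.∏fall-cong {r = lookup r} (count-molecules cfg) (λ _ → ≡.refl)))

  module _ {m} (v : Carrier) (cfg : Vec ℕ m) (o : ℕ) where
    private
      N : Vec ℕ m → ℕ
      N = #draws o (molecules cfg)

    propensity-* : ∀ α → order α ≡ o →
      propensity cfg v α * fromℕ (o ℕ.!) ≈ volumeFactor v o * (rate α * fromℕ (N (reactants α)))
    propensity-* α order≡o = begin
      rate α * volumeFactor v (order α) * Q * fromℕ (o ℕ.!) ≡⟨ ≡.cong (λ n → rate α * volumeFactor v n * Q * fromℕ (o ℕ.!)) order≡o ⟩
      rate α * volumeFactor v o * Q * fromℕ (o ℕ.!)         ≈⟨ solve 4 (λ k V Q f → ((k ⊕ V) ⊕ Q) ⊕ f ⊜ V ⊕ (k ⊕ (f ⊕ Q)))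
                                                                   ≈-refl (rate α) (volumeFactor v o) Q (fromℕ (o ℕ.!)) ⟩
      volumeFactor v o * (rate α * (fromℕ (o ℕ.!) * Q))     ≈⟨ *-congˡ (*-congˡ (reactantChoices-draws cfg (reactants α) order≡o)) ⟩
      volumeFactor v o * (rate α * fromℕ (N (reactants α))) ∎
      where
      open import Algebra.Solver.CommutativeMonoid *-commutativeMonoid using (solve; _⊕_; _⊜_)
      Q : Carrier
      Q = reactantChoices cfg (reactants α)

    sumF-propensity-* : ∀ αs → All (λ α → order α ≡ o) αs →
      sumF (map (propensity cfg v) αs) * fromℕ (o ℕ.!)
        ≈ volumeFactor v o * sumF (map (λ α → rate α * fromℕ (N (reactants α))) αs)
    sumF-propensity-* αs orders = begin
      sumF (map (propensity cfg v) αs) * fromℕ (o ℕ.!)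
        ≈⟨ sumF-*ʳ (fromℕ (o ℕ.!)) (propensity cfg v) αs ⟩
      sumF (map (λ α → propensity cfg v α * fromℕ (o ℕ.!)) αs)
        ≈⟨ sumF-cong (All.map (λ {α} → propensity-* α) orders) ⟩
      sumF (map (λ α → volumeFactor v o * (rate α * fromℕ (N (reactants α)))) αs)
        ≈⟨ sumF-*ˡ (volumeFactor v o) (λ α → rate α * fromℕ (N (reactants α))) αs ⟨
      volumeFactor v o * sumF (map (λ α → rate α * fromℕ (N (reactants α))) αs) ∎

  K-as-indicatorSum : ∀ {m} (R : CRNet m) r → K R r ≈ sumF (map (λ α → rate α * indicator (r ≟v reactants α)) R)
  K-as-indicatorSum []      r = ≈-refl
  K-as-indicatorSum (α ∷ R) r with reactants α ≟v r | r ≟v reactants α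
  ... | yes _   | yes _   = +-cong (≈-sym (*-identityʳ _)) (K-as-indicatorSum R r)
  ... | no _    | no _    = ≈-trans (K-as-indicatorSum R r) (≈-trans (≈-sym (+-identityˡ _)) (+-congʳ (≈-sym (zeroʳ _))))
  ... | yes α≡r | no r≢α  = contradiction (≡.sym α≡r) r≢α
  ... | no α≢r  | yes r≡α = contradiction (≡.sym r≡α) α≢r

  rate-weighted-#draws : ∀ {m} (R : CRNet m) D →
    sumF (map (λ α → rate α * fromℕ (length (filter (λ d → speciesCount d ≟v reactants α) D))) R)
      ≈ sumF (map (λ d → K R (speciesCount d)) D)
  rate-weighted-#draws R D = begin
    sumF (map (λ α → rate α * fromℕ (length (filter (λ d → speciesCount d ≟v reactants α) D))) R)
      ≈⟨ sumF-cong {xs = R} (All.tabulate λ {α} _ →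
           ≈-trans (*-congˡ (fromℕ-length-filter (λ d → speciesCount d ≟v reactants α) D)) (sumF-*ˡ (rate α) _ D)) ⟩
    sumF (map (λ α → sumF (map (λ d → rate α * indicator (speciesCount d ≟v reactants α)) D)) R)
      ≈⟨ sumF-swap (λ α d → rate α * indicator (speciesCount d ≟v reactants α)) R D ⟩
    sumF (map (λ d → sumF (map (λ α → rate α * indicator (speciesCount d ≟v reactants α)) R)) D)
      ≈⟨ sumF-cong {xs = D} (All.tabulate λ {d} _ → ≈-sym (K-as-indicatorSum R (speciesCount d))) ⟩
    sumF (map (λ d → K R (speciesCount d)) D) ∎

  ord-constant : ∀ {m} {n} (α : Reaction m) αs → All (λ β → order β ≡ n) (α ∷ αs) → ord (α ∷ αs) ≡ n
  ord-constant α []       (order≡n ∷ [])   = ≡.trans (ℕ.⊔-identityʳ (order α)) order≡n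
  ord-constant α (β ∷ αs) (order≡n ∷ rest) = ≡.trans (≡.cong₂ ℕ._⊔_ order≡n (ord-constant β αs rest)) (ℕ.⊔-idem _)

  K-pos : ∀ {m} (α : Reaction m) αs → ValidRates (α ∷ αs) → 0# < K (α ∷ αs) (reactants α)
  K-pos α αs (0<rate ∷ rates-pos) with reactants α ≟v reactants α
  ... | yes _ = sumF-pos rate {α} {filter P? αs} (0<rate ∷ All.filter⁺ P? rates-pos)
    where
    P? : (β : Reaction _) → Dec (reactants β ≡ reactants α)
    P? β = reactants β ≟v reactants α
  ... | no α≢α = contradiction ≡.refl α≢α

  volumeFactor-≉0 : ∀ {v} → 0# < v → ∀ n → volumeFactor v n ≉ 0#
  volumeFactor-≉0 0<v ℕ.zero    = pos⇒≉0 0<v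
  volumeFactor-≉0 0<v (ℕ.suc n) = ⁻¹-≉0 (pos⇒≉0 (power-pos n))
    where
    power-pos : ∀ n → 0# < V.foldr _ _*_ 1# (V.replicate n _)
    power-pos ℕ.zero    = 0<1
    power-pos (ℕ.suc n) = *-pos 0<v (power-pos n)

  module UniformSetting {m} (R : CRNet m) (v : Carrier) (cfg : Vec ℕ m)
                        (orders : All (λ α → order α ≡ ord R) R)
                        (K₀ : Carrier) (K≈K₀ : ∀ r → ‖ r ‖ ≡ ord R → K R r ≈ K₀) where
    private
      o : ℕ
      o = ord R
      D : List (List (Fin m))
      D = draws o (molecules cfg)
      N : Vec ℕ m → ℕ
      N = #draws o (molecules cfg)
      L S o! : Carrier
      L = fromℕ (length D)
      S = sumF (map (propensity cfg v) R)
      o! = fromℕ (o ℕ.!)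

    numerator-* : ∀ r → sumF (map (propensity cfg v) (withReactants R r)) * o! ≈ volumeFactor v o * (K R r * fromℕ (N r))
    numerator-* r = ≈-trans (sumF-propensity-* v cfg o W (All.filter⁺ (λ α → reactants α ≟v r) orders)) (*-congˡ (begin
      sumF (map (λ α → rate α * fromℕ (N (reactants α))) W)
        ≈⟨ sumF-cong (All.map (λ α≡r → *-congˡ (≈-reflexive (≡.cong (fromℕ ∘ N) α≡r))) (All.all-filter (λ α → reactants α ≟v r) R)) ⟩
      sumF (map (λ α → rate α * fromℕ (N r)) W)
        ≈⟨ sumF-*ʳ (fromℕ (N r)) rate W ⟨
      K R r * fromℕ (N r) ∎))
      where
      W : CRNet m
      W = withReactants R r

    denominator-* : S * o! ≈ volumeFactor v o * (L * K₀)
    denominator-* = ≈-trans (sumF-propensity-* v cfg o R orders) (*-congˡ (begin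
      sumF (map (λ α → rate α * fromℕ (N (reactants α))) R) ≈⟨ rate-weighted-#draws R D ⟩
      sumF (map (λ d → K R (speciesCount d)) D)             ≈⟨ sumF-cong (All.map (λ {d} length≡o →
                                                                  K≈K₀ (speciesCount d) (≡.trans (‖speciesCount‖ d) length≡o))
                                                                (draws-length o (molecules cfg))) ⟩
      sumF (map (λ _ → K₀) D)                               ≈⟨ sumF-const K₀ D ⟩
      L * K₀                                                ∎))

    -- Uniform reactivity constrains K only on vectors of size o, but no other vector is ever drawn.
    K*#draws : ∀ r → K R r * fromℕ (N r) ≈ K₀ * fromℕ (N r)
    K*#draws r with ‖ r ‖ ℕ.≟ o
    ... | yes ‖r‖≡o = *-congʳ (K≈K₀ r ‖r‖≡o)
    ... | no ‖r‖≢o  = ≈-trans (*-congˡ N≈0) (≈-trans (zeroʳ _) (≈-sym (≈-trans (*-congˡ N≈0) (zeroʳ _))))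
      where
      N≈0 : fromℕ (N r) ≈ 0#
      N≈0 = ≈-reflexive (≡.cong (fromℕ ∘ length) (List.filter-none (λ d → speciesCount d ≟v r)
              (All.map (λ {d} length≡o d≡r → ‖r‖≢o (≡.trans (≡.cong ‖_‖ (≡.sym d≡r)) (≡.trans (‖speciesCount‖ d) length≡o)))
                       (draws-length o (molecules cfg)))))

    PrX≈PrY : volumeFactor v o ≉ 0# → L ≉ 0# → K₀ ≉ 0# → ∀ r → PrX R v cfg r ≈ PrY o cfg r
    PrX≈PrY Vf≉0 L≉0 K₀≉0 r = *-⁻¹-cross S≉0 L≉0 (*-cancelʳ o!≉0 (begin
      Num * L * o!                   ≈⟨ solve 3 (λ n l f → (n ⊕ l) ⊕ f ⊜ (n ⊕ f) ⊕ l) ≈-refl Num L o! ⟩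
      Num * o! * L                   ≈⟨ *-congʳ (numerator-* r) ⟩
      Vf * (K R r * fromℕ (N r)) * L ≈⟨ *-congʳ (*-congˡ (K*#draws r)) ⟩
      Vf * (K₀ * fromℕ (N r)) * L    ≈⟨ solve 4 (λ V k n l → (V ⊕ (k ⊕ n)) ⊕ l ⊜ n ⊕ (V ⊕ (l ⊕ k))) ≈-refl Vf K₀ (fromℕ (N r)) L ⟩
      fromℕ (N r) * (Vf * (L * K₀))  ≈⟨ *-congˡ denominator-* ⟨
      fromℕ (N r) * (S * o!)         ≈⟨ *-assoc _ S o! ⟨
      fromℕ (N r) * S * o!           ∎))
      where
      open import Algebra.Solver.CommutativeMonoid *-commutativeMonoid using (solve; _⊕_; _⊜_)
      Vf Num : Carrier
      Vf = volumeFactor v o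
      Num = sumF (map (propensity cfg v) (withReactants R r))
      o!≉0 : o! ≉ 0#
      o!≉0 = fromℕ-≉0 (ℕ.1≤n! o)
      S≉0 : S ≉ 0#
      S≉0 S≈0 = *-≉0 Vf≉0 (*-≉0 L≉0 K₀≉0) (≈-trans (≈-sym denominator-*) (≈-trans (*-congʳ S≈0) (zeroˡ o!)))

lemma6 : ∀ {c ℓ₁ ℓ₂} (F : OrderedField c ℓ₁ ℓ₂) →
    let open OrderedField F
        open CRN F
    in ∀ {m} (R : CRNet m) → ValidRates R → UniformlyReactive R → R ≢ [] →
       (v : Carrier) → 0# < v →
       (cfg : Vec ℕ m) → ord R ≤ ‖ cfg ‖ →
       (r : Vec ℕ m) → PrX R v cfg r ≈ PrY (ord R) cfg r
lemma6 F []         _     _                 R≢[] = contradiction refl R≢[]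
lemma6 F (α₀ ∷ αs) rates (uniform , K-const) _ v 0<v cfg o≤‖cfg‖ =
  UniformSetting.PrX≈PrY (α₀ ∷ αs) v cfg orders (K (α₀ ∷ αs) (reactants α₀))
    (λ r ‖r‖≡o → K-const r (reactants α₀) ‖r‖≡o ‖α₀‖≡o)
    (volumeFactor-≉0 0<v (ord (α₀ ∷ αs)))
    (fromℕ-≉0 (draws-nonempty _ (molecules cfg) (subst (ord (α₀ ∷ αs) ≤_) (sym (length-molecules cfg)) o≤‖cfg‖)))
    (pos⇒≉0 (K-pos α₀ αs rates))
  where
  open CRN F
  open Sampling F
  open FieldArithmetic F
  open Gillespie F
  same-order : All (λ α → order α ≡ order α₀) (α₀ ∷ αs)
  same-order = All.tabulate λ α∈R → proj₁ (uniform α∈R (here refl))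
  ‖α₀‖≡o : ‖ reactants α₀ ‖ ≡ ord (α₀ ∷ αs)
  ‖α₀‖≡o = sym (ord-constant α₀ αs same-order)
  orders : All (λ α → order α ≡ ord (α₀ ∷ αs)) (α₀ ∷ αs)
  orders = All.map (λ order≡ → trans order≡ ‖α₀‖≡o) same-order
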